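{- Let $G_1=(\{0,\dots,n-1\},E_1)$ and $G_2=(\{0,\dots,n-1\},E_2)$ be simple graphs without vertices of degree $0$, and let $k=2n+4$. Then $G_1$ and $G_2$ are isomorphic if and only if there exists an automorphism $A$ of the cube $k^2$ with $s^{G_1}(v)=s^{G_2}(A(v))$ for all $v\in[k]^2$.
   Context: For a simple graph $G=(\{0,\dots,n-1\},E)$ and $k=2n+4$, the coloring $s^G:[k]^2\to\{0,1\}$ (where $[k]=\{0,\dots,k-1\}$) is defined by $s^G([i,j])=1$ if $[i,j]=[n,n]$, or $[i,j]=[n,n+1]$, or ($i,j\le n-1$ and $\{i,j\}\in E$); otherwise $s^G([i,j])=0$. A set of $k$ distinct points of $[k]^2$ is a line if it can be ordered $(q^1,\dots,q^k)$ such that in each coordinate the sequence of values is strictly increasing, strictly decreasing or constant, with at least one coordinate non-constant. An automorphism of the cube $k^2$ is a permutation of $[k]^2$ mapping every line onto a line. -}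

module Defs where

open import Data.Nat as ℕ using (ℕ; suc; _+_; _*_; _<?_; _≡ᵇ_)
open import Data.Fin as Fin using (Fin; toℕ; fromℕ<)
open import Data.Bool using (Bool; true; false; _∧_; _∨_)
open import Data.Product using (Σ; ∃; _×_; _,_; proj₁; proj₂)
open import Data.Sum using (_⊎_)
open import Data.Empty using (⊥)
open import Relation.Nullary using (yes; no)
open import Relation.Binary.PropositionalEquality using (_≡_)
open import Function.Bundles using (_⇔_; _↔_; Inverse)
open import Function.Definitions using (Injective)

record SimpleGraph (n : ℕ) : Set where
  field
    adj       : Fin n → Fin n → Bool
    adj-sym   : ∀ u v → adj u v ≡ adj v u
    adj-irrefl : ∀ v → adj v v ≡ false
open SimpleGraph public

NoIsolated : ∀ {n} → SimpleGraph n → Set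
NoIsolated {n} G = ∀ (v : Fin n) → ∃ λ (u : Fin n) → adj G v u ≡ true

Isomorphic : ∀ {n} → SimpleGraph n → SimpleGraph n → Set
Isomorphic {n} G₁ G₂ =
  Σ (Fin n ↔ Fin n) λ σ →
    ∀ u v → adj G₁ u v ≡ adj G₂ (Inverse.to σ u) (Inverse.to σ v)

Point : ℕ → Set
Point k = Fin k × Fin k

StrictlyIncreasing : ∀ {k} → (Fin k → Fin k) → Set
StrictlyIncreasing f = ∀ i j → i Fin.< j → f i Fin.< f j

StrictlyDecreasing : ∀ {k} → (Fin k → Fin k) → Set
StrictlyDecreasing f = ∀ i j → i Fin.< j → f j Fin.< f i

Constant : ∀ {k} → (Fin k → Fin k) → Set
Constant f = ∀ i j → f i ≡ f j

MonoOrConst : ∀ {k} → (Fin k → Fin k) → Set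
MonoOrConst f = StrictlyIncreasing f ⊎ StrictlyDecreasing f ⊎ Constant f

IsLine : ∀ {k} → (Point k → Set) → Set
IsLine {k} S =
  Σ (Fin k → Point k) λ q →
      (∀ p → S p ⇔ (∃ λ i → q i ≡ p))
    × Injective _≡_ _≡_ q
    × MonoOrConst (λ i → proj₁ (q i))
    × MonoOrConst (λ i → proj₂ (q i))
    × ((Constant (λ i → proj₁ (q i)) → ⊥) ⊎ (Constant (λ i → proj₂ (q i)) → ⊥))

Image : ∀ {k} → (Point k → Point k) → (Point k → Set) → (Point k → Set)
Image A S p = ∃ λ v → S v × A v ≡ p

IsCubeAutomorphism : ∀ {k} → (Point k ↔ Point k) → Set₁
IsCubeAutomorphism {k} A = ∀ (S : Point k → Set) → IsLine S → IsLine (Image (Inverse.to A) S)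

s : ∀ {n} → SimpleGraph n → Point (2 * n + 4) → Bool
s {n} G (i , j) with toℕ i <? n | toℕ j <? n
... | yes i<n | yes j<n = adj G (fromℕ< i<n) (fromℕ< j<n)
... | _       | _       = (toℕ i ≡ᵇ n) ∧ ((toℕ j ≡ᵇ n) ∨ (toℕ j ≡ᵇ suc n))

module Submission where

-- A strictly increasing self-map of Fin k is the identity and a strictly decreasing
-- one is `opposite`, so every line of k² is a row, a column, the diagonal or the antidiagonal
-- (a `Shape`); conversely every shape is a line once k ≥ 2.
-- Automorphisms.  An automorphism maps shapes onto shapes, preserving disjointness.  For
-- k ≥ 3 a pairwise disjoint family of k shapes consists of rows only or of columns only, so
-- the rows go to parallel lines and so do the columns: A(i, j) = (α i, β j) or (β j, α i).
-- Moreover A sends the diagonal to the diagonal or to the antidiagonal.  Conversely, φ × φ is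
-- an automorphism whenever the permutation φ of the side commutes with `opposite`.  Colour preservation rules out the exchanged and the antidiagonal cases, so
-- A = α × α; using that every vertex has a neighbour, α maps the vertices onto the vertices and
-- restricts to an isomorphism G₁ ≅ G₂.  Conversely an isomorphism σ extends to a permutation
-- of the side (σ on the vertices, mirrored on their opposites, the identity on the middle four
-- points) commuting with `opposite`, whose square preserves the colouring.

open import Defs
open import Data.Nat as ℕ using (ℕ; zero; suc; _+_; _*_; z≤n; s≤s; _<?_; _≡ᵇ_)
open import Data.Bool using (Bool; true; T; _∧_; _∨_)
open import Data.Bool.Properties using (T-≡; T-∧; T-∨)
open import Data.Nat.Properties
open import Data.Fin as Fin using (Fin; toℕ; fromℕ<; opposite; inject₁; inject≤)
open import Data.Fin.Properties as FinP
  using ( toℕ-injective; toℕ<n; toℕ-fromℕ<; toℕ-inject₁; toℕ-inject≤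
        ; opposite-prop; opposite-involutive; ≤̄⇒inject₁<)
open import Data.Fin.Induction using (<-weakInduction)
open import Data.Product using (Σ; ∃; _×_; _,_; proj₁; proj₂; swap; uncurry)
open import Data.Sum as Sum using (_⊎_; inj₁; inj₂; [_,_]′)
open import Data.Empty using (⊥; ⊥-elim)
open import Data.Unit using (⊤; tt)
open import Function using (_∘_)
open import Function.Bundles using (_⇔_; _↔_; Inverse; Injection; Equivalence; mk⇔; mk↔ₛ′)
open import Function.Properties.Inverse using (↔⇒↣; ↔-sym)
open import Function.Definitions using (Injective)
import Function.Properties.Equivalence as ⇔
open import Relation.Nullary using (¬_; Dec; yes; no)
open import Relation.Nullary.Decidable using (does-⇔)
open import Relation.Binary.PropositionalEquality

private
  variable
    k : ℕ

opposite-< : {i j : Fin k} → i Fin.< j → opposite j Fin.< opposite i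
opposite-< {i = i} {j} i<j rewrite opposite-prop i | opposite-prop j = ∸-monoʳ-< (s≤s i<j) (toℕ<n j)

opposite-≤-reflect : {i j : Fin k} → toℕ (opposite i) ℕ.≤ toℕ (opposite j) → toℕ j ℕ.≤ toℕ i
opposite-≤-reflect opp-i≤opp-j = ≮⇒≥ (λ i<j → <⇒≱ (opposite-< i<j) opp-i≤opp-j)

opposite-injective : {i j : Fin k} → opposite i ≡ opposite j → i ≡ j
opposite-injective {i = i} {j} e = trans (sym (opposite-involutive i)) (trans (cong opposite e) (opposite-involutive j))

opposite-sum : (i : Fin k) → toℕ (opposite i) + suc (toℕ i) ≡ k
opposite-sum i = trans (cong (_+ suc (toℕ i)) (opposite-prop i)) (m∸n+n≡m (toℕ<n i))

increasing-≥ : (f : Fin k → Fin k) → StrictlyIncreasing f → ∀ i → toℕ i ℕ.≤ toℕ (f i)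
increasing-≥ {suc k} f increasing = <-weakInduction (λ i → toℕ i ℕ.≤ toℕ (f i)) z≤n step
  where
  step : ∀ i → toℕ (inject₁ i) ℕ.≤ toℕ (f (inject₁ i)) → toℕ (Fin.suc i) ℕ.≤ toℕ (f (Fin.suc i))
  step i below = ≤-trans (s≤s (≤-trans (≤-reflexive (sym (toℕ-inject₁ i))) below))
                         (increasing (inject₁ i) (Fin.suc i) (≤̄⇒inject₁< FinP.≤-refl))

-- Hence a strictly increasing self-map of Fin k is the identity: conjugating it by
-- `opposite` gives another increasing map, which bounds it from above.
increasing⇒id : (f : Fin k → Fin k) → StrictlyIncreasing f → ∀ i → f i ≡ i
increasing⇒id f increasing i = toℕ-injective (≤-antisym below (increasing-≥ f increasing i))
  where
  mirrored : StrictlyIncreasing (λ x → opposite (f (opposite x)))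
  mirrored a b a<b = opposite-< (increasing _ _ (opposite-< a<b))

  below : toℕ (f i) ℕ.≤ toℕ i
  below = opposite-≤-reflect
    (subst (λ y → toℕ (opposite i) ℕ.≤ toℕ (opposite (f y))) (opposite-involutive i)
           (increasing-≥ _ mirrored (opposite i)))

decreasing⇒opposite : (f : Fin k → Fin k) → StrictlyDecreasing f → ∀ i → f i ≡ opposite i
decreasing⇒opposite f decreasing i = begin
  f i                       ≡⟨ cong f (opposite-involutive i) ⟨
  f (opposite (opposite i)) ≡⟨ increasing⇒id (f ∘ opposite) reversed (opposite i) ⟩
  opposite i                ∎
  where
  open ≡-Reasoning
  reversed : StrictlyIncreasing (f ∘ opposite)
  reversed a b a<b = decreasing _ _ (opposite-< a<b)

data Shape (k : ℕ) : Set where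
  row column            : Fin k → Shape k
  diagonal antidiagonal : Shape k

_∈ₛ_ : Point k → Shape k → Set
(i , j) ∈ₛ row a        = i ≡ a
(i , j) ∈ₛ column b     = j ≡ b
(i , j) ∈ₛ diagonal     = i ≡ j
(i , j) ∈ₛ antidiagonal = j ≡ opposite i

-- The behaviour of one coordinate along a line (by the lemmas above, the only possible ones).
data Coordinate (k : ℕ) : Set where
  ascending descending : Coordinate k
  fixed                : Fin k → Coordinate k

⟦_⟧ : Coordinate k → Fin k → Fin k
⟦ ascending ⟧  i = i
⟦ descending ⟧ i = opposite i
⟦ fixed a ⟧    _ = a

⟦⟧-monotone : (c : Coordinate k) → MonoOrConst ⟦ c ⟧
⟦⟧-monotone ascending  = inj₁ (λ _ _ i<j → i<j)
⟦⟧-monotone descending = inj₂ (inj₁ (λ _ _ → opposite-<))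
⟦⟧-monotone (fixed a)  = inj₂ (inj₂ (λ _ _ → refl))

IsFixed : Coordinate k → Set
IsFixed (fixed _) = ⊤
IsFixed _         = ⊥

curve : Coordinate k → Coordinate k → Fin k → Point k
curve c₁ c₂ i = ⟦ c₁ ⟧ i , ⟦ c₂ ⟧ i

shapeOf : Coordinate k → Coordinate k → Shape k
shapeOf ascending  ascending  = diagonal
shapeOf ascending  descending = antidiagonal
shapeOf descending ascending  = antidiagonal
shapeOf descending descending = diagonal
shapeOf (fixed a)  _          = row a
shapeOf _          (fixed b)  = column b

curve-traces : (c₁ c₂ : Coordinate k) → ¬ (IsFixed c₁ × IsFixed c₂) →
               ∀ p → p ∈ₛ shapeOf c₁ c₂ ⇔ (∃ λ i → curve c₁ c₂ i ≡ p)
curve-traces ascending ascending _ (a , b) =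
  mk⇔ (λ { refl → a , refl }) (λ { (i , refl) → refl })
curve-traces ascending descending _ (a , b) =
  mk⇔ (λ { refl → a , refl }) (λ { (i , refl) → refl })
curve-traces descending ascending _ (a , b) =
  mk⇔ (λ { refl → opposite a , cong (_, opposite a) (opposite-involutive a) })
      (λ { (i , refl) → sym (opposite-involutive i) })
curve-traces descending descending _ (a , b) =
  mk⇔ (λ { refl → opposite a , cong₂ _,_ (opposite-involutive a) (opposite-involutive a) })
      (λ { (i , refl) → refl })
curve-traces (fixed c) ascending _ (a , b) =
  mk⇔ (λ { refl → b , refl }) (λ { (i , refl) → refl })
curve-traces (fixed c) descending _ (a , b) =
  mk⇔ (λ { refl → opposite b , cong (c ,_) (opposite-involutive b) }) (λ { (i , refl) → refl })
curve-traces ascending (fixed c) _ (a , b) =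
  mk⇔ (λ { refl → a , refl }) (λ { (i , refl) → refl })
curve-traces descending (fixed c) _ (a , b) =
  mk⇔ (λ { refl → opposite a , cong (_, c) (opposite-involutive a) }) (λ { (i , refl) → refl })
curve-traces (fixed _) (fixed _) both-fixed _ = ⊥-elim (both-fixed (tt , tt))

coordinate-kind : Fin k → (f : Fin k → Fin k) → MonoOrConst f →
                  Σ (Coordinate k) λ c → ∀ i → f i ≡ ⟦ c ⟧ i
coordinate-kind _ f (inj₁ increasing)        = ascending , increasing⇒id f increasing
coordinate-kind _ f (inj₂ (inj₁ decreasing)) = descending , decreasing⇒opposite f decreasing
coordinate-kind o f (inj₂ (inj₂ constant))   = fixed (f o) , λ i → constant i o

fixed⇒constant : (f : Fin k → Fin k) (c : Coordinate k) → (∀ i → f i ≡ ⟦ c ⟧ i) → IsFixed c → Constant f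
fixed⇒constant f (fixed a) f≡c _ i j = trans (f≡c i) (sym (f≡c j))

-- A line has a non-constant coordinate, and on a side of length < 2 every map is constant:
-- so lines exist only for k ≥ 2.
constant-below-2 : k ℕ.< 2 → (f : Fin k → Fin k) → Constant f
constant-below-2 {suc zero}          _ f Fin.zero Fin.zero = refl
constant-below-2 {suc (suc _)} (s≤s (s≤s ()))

line⇒2≤k : {S : Point k → Set} → IsLine S → 2 ℕ.≤ k
line⇒2≤k (_ , _ , _ , _ , _ , moving) =
  ≮⇒≥ (λ k<2 → [ (λ h → h (constant-below-2 k<2 _)) , (λ h → h (constant-below-2 k<2 _)) ]′ moving)

origin : 2 ℕ.≤ k → Fin k
origin {suc _} _ = Fin.zero

injective-moves : 2 ℕ.≤ k → {f : Fin k → Fin k} → Injective _≡_ _≡_ f → ¬ Constant f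
injective-moves {suc zero} (s≤s ())
injective-moves {suc (suc _)} _ f-injective constant = FinP.0≢1+n (f-injective (constant Fin.zero (Fin.suc Fin.zero)))

same-trace : {q q′ : Fin k → Point k} → (∀ i → q i ≡ q′ i) →
             ∀ p → (∃ λ i → q i ≡ p) ⇔ (∃ λ i → q′ i ≡ p)
same-trace q≡q′ p = mk⇔ (λ { (i , refl) → i , sym (q≡q′ i) }) (λ { (i , refl) → i , q≡q′ i })

line⇒shape : {S : Point k → Set} → IsLine S → Σ (Shape k) λ X → ∀ p → S p ⇔ p ∈ₛ X
line⇒shape line@(q , traced , _ , mono₁ , mono₂ , moving)
  with coordinate-kind (origin (line⇒2≤k line)) _ mono₁ | coordinate-kind (origin (line⇒2≤k line)) _ mono₂
... | c₁ , q₁≡c₁ | c₂ , q₂≡c₂ = shapeOf c₁ c₂ , λ p →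
  ⇔.trans (traced p) (⇔.trans (same-trace (λ i → cong₂ _,_ (q₁≡c₁ i) (q₂≡c₂ i)) p)
                                (⇔.sym (curve-traces c₁ c₂ not-both-fixed p)))
  where
  not-both-fixed : ¬ (IsFixed c₁ × IsFixed c₂)
  not-both-fixed (fixed₁ , fixed₂) =
    [ (λ h → h (fixed⇒constant _ c₁ q₁≡c₁ fixed₁))
    , (λ h → h (fixed⇒constant _ c₂ q₂≡c₂ fixed₂)) ]′ moving

ascending-moves : 2 ℕ.≤ k → ¬ Constant ⟦ ascending ⟧
ascending-moves 2≤k = injective-moves 2≤k (λ e → e)

curve-isLine : (c₁ c₂ : Coordinate k) → ¬ (IsFixed c₁ × IsFixed c₂) →
               (¬ Constant ⟦ c₁ ⟧ ⊎ ¬ Constant ⟦ c₂ ⟧) → Injective _≡_ _≡_ (curve c₁ c₂) →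
               IsLine (_∈ₛ shapeOf c₁ c₂)
curve-isLine c₁ c₂ not-both-fixed moving injective =
  curve c₁ c₂ , curve-traces c₁ c₂ not-both-fixed , injective , ⟦⟧-monotone c₁ , ⟦⟧-monotone c₂ , moving

shape-isLine : 2 ℕ.≤ k → (X : Shape k) → IsLine (_∈ₛ X)
shape-isLine 2≤k (row a)      = curve-isLine (fixed a) ascending (λ ()) (inj₂ (ascending-moves 2≤k)) (cong proj₂)
shape-isLine 2≤k (column b)   = curve-isLine ascending (fixed b) (λ ()) (inj₁ (ascending-moves 2≤k)) (cong proj₁)
shape-isLine 2≤k diagonal     = curve-isLine ascending ascending (λ ()) (inj₁ (ascending-moves 2≤k)) (cong proj₁)
shape-isLine 2≤k antidiagonal = curve-isLine ascending descending (λ ()) (inj₁ (ascending-moves 2≤k)) (cong proj₁)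

isLine-⇔ : {S T : Point k → Set} → (∀ p → S p ⇔ T p) → IsLine T → IsLine S
isLine-⇔ S⇔T (q , traced , rest) = q , (λ p → ⇔.trans (S⇔T p) (traced p)) , rest

Disjoint : Shape k → Shape k → Set
Disjoint X Y = ∀ p → p ∈ₛ X → p ∈ₛ Y → ⊥

self-meeting : Fin k → (X : Shape k) → ¬ Disjoint X X
self-meeting o (row b)      disjoint = disjoint (b , o) refl refl
self-meeting o (column b)   disjoint = disjoint (o , b) refl refl
self-meeting o diagonal     disjoint = disjoint (o , o) refl refl
self-meeting o antidiagonal disjoint = disjoint (o , opposite o) refl refl

disjoint-row : (X : Shape k) {a : Fin k} → Disjoint X (row a) → ∃ λ b → X ≡ row b
disjoint-row (row b)      _         = b , refl
disjoint-row (column b)   {a} disjoint = ⊥-elim (disjoint (a , b) refl refl)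
disjoint-row diagonal     {a} disjoint = ⊥-elim (disjoint (a , a) refl refl)
disjoint-row antidiagonal {a} disjoint = ⊥-elim (disjoint (a , opposite a) refl refl)

disjoint-column : (X : Shape k) {a : Fin k} → Disjoint X (column a) → ∃ λ b → X ≡ column b
disjoint-column (column b)   _         = b , refl
disjoint-column (row b)      {a} disjoint = ⊥-elim (disjoint (b , a) refl refl)
disjoint-column diagonal     {a} disjoint = ⊥-elim (disjoint (a , a) refl refl)
disjoint-column antidiagonal {a} disjoint =
  ⊥-elim (disjoint (opposite a , a) (sym (opposite-involutive a)) refl)

disjoint-diagonal : Fin k → (X : Shape k) → Disjoint X diagonal → X ≡ antidiagonal
disjoint-diagonal _ (row b)      disjoint = ⊥-elim (disjoint (b , b) refl refl)
disjoint-diagonal _ (column b)   disjoint = ⊥-elim (disjoint (b , b) refl refl)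
disjoint-diagonal o diagonal     disjoint = ⊥-elim (self-meeting o diagonal disjoint)
disjoint-diagonal _ antidiagonal _        = refl

disjoint-antidiagonal : Fin k → (X : Shape k) → Disjoint X antidiagonal → X ≡ diagonal
disjoint-antidiagonal _ (row b)      disjoint = ⊥-elim (disjoint (b , opposite b) refl refl)
disjoint-antidiagonal _ (column b)   disjoint =
  ⊥-elim (disjoint (opposite b , b) refl (sym (opposite-involutive b)))
disjoint-antidiagonal _ diagonal     _        = refl
disjoint-antidiagonal o antidiagonal disjoint = ⊥-elim (self-meeting o antidiagonal disjoint)

AllRows AllColumns : (Fin k → Shape k) → Set
AllRows    F = ∀ r → ∃ λ b → F r ≡ row b
AllColumns F = ∀ r → ∃ λ b → F r ≡ column b

-- A pairwise disjoint family of k ≥ 3 shapes consists of rows only or of columns only: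
-- three pairwise disjoint shapes cannot involve a diagonal.
disjoint-family : 3 ℕ.≤ k → (F : Fin k → Shape k) → (∀ r r′ → r ≢ r′ → Disjoint (F r) (F r′)) →
                  AllRows F ⊎ AllColumns F
disjoint-family {suc zero}       (s≤s ())
disjoint-family {suc (suc zero)} (s≤s (s≤s ()))
disjoint-family {suc (suc (suc _))} _ F disjoint with F Fin.zero in F₀
... | row a = inj₁ rows
  where
  rows : AllRows F
  rows r with r FinP.≟ Fin.zero
  ... | yes refl = a , F₀
  ... | no r≢0   = disjoint-row (F r) (subst (Disjoint (F r)) F₀ (disjoint r Fin.zero r≢0))
... | column a = inj₂ columns
  where
  columns : AllColumns F
  columns r with r FinP.≟ Fin.zero
  ... | yes refl = a , F₀
  ... | no r≢0   = disjoint-column (F r) (subst (Disjoint (F r)) F₀ (disjoint r Fin.zero r≢0))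
... | diagonal = ⊥-elim (self-meeting Fin.zero antidiagonal
                   (subst₂ Disjoint (opposed Fin.zero) (opposed (Fin.suc Fin.zero)) (disjoint _ _ (λ ()))))
  where
  opposed : ∀ i → F (Fin.suc i) ≡ antidiagonal
  opposed i = disjoint-diagonal Fin.zero _ (subst (Disjoint (F (Fin.suc i))) F₀ (disjoint _ _ (λ ())))
... | antidiagonal = ⊥-elim (self-meeting Fin.zero diagonal
                   (subst₂ Disjoint (opposed Fin.zero) (opposed (Fin.suc Fin.zero)) (disjoint _ _ (λ ()))))
  where
  opposed : ∀ i → F (Fin.suc i) ≡ diagonal
  opposed i = disjoint-antidiagonal Fin.zero _ (subst (Disjoint (F (Fin.suc i))) F₀ (disjoint _ _ (λ ())))

-- A cube automorphism A (k ≥ 2) maps each shape onto a shape, and exactly so: since A is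
-- injective, v lies on X iff A v lies on the image of X.
module ShapeAction {k : ℕ} (A : Point k ↔ Point k) (automorphism : IsCubeAutomorphism A) (2≤k : 2 ℕ.≤ k) where
  open Inverse A using (to)

  to-injective : Injective _≡_ _≡_ to
  to-injective = Injection.injective (↔⇒↣ A)

  image : Shape k → Shape k
  image X = proj₁ (line⇒shape (automorphism (_∈ₛ X) (shape-isLine 2≤k X)))

  exact : ∀ X v → v ∈ₛ X ⇔ to v ∈ₛ image X
  exact X v = mk⇔ (λ v∈X → Equivalence.to (image-⇔ (to v)) (v , v∈X , refl))
                  (λ Av∈Y → pull-back (Equivalence.from (image-⇔ (to v)) Av∈Y))
    where
    image-⇔ : ∀ p → Image to (_∈ₛ X) p ⇔ p ∈ₛ image X
    image-⇔ = proj₂ (line⇒shape (automorphism (_∈ₛ X) (shape-isLine 2≤k X)))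
    pull-back : Image to (_∈ₛ X) (to v) → v ∈ₛ X
    pull-back (w , w∈X , Aw≡Av) = subst (_∈ₛ X) (to-injective Aw≡Av) w∈X

  on-row : ∀ X {b} → image X ≡ row b → ∀ v → v ∈ₛ X ⇔ proj₁ (to v) ≡ b
  on-row X image≡row v = subst (λ Y → v ∈ₛ X ⇔ to v ∈ₛ Y) image≡row (exact X v)

  on-column : ∀ X {b} → image X ≡ column b → ∀ v → v ∈ₛ X ⇔ proj₂ (to v) ≡ b
  on-column X image≡column v = subst (λ Y → v ∈ₛ X ⇔ to v ∈ₛ Y) image≡column (exact X v)

  image-disjoint : ∀ X Y → Disjoint X Y → Disjoint (image X) (image Y)
  image-disjoint X Y disjoint p p∈X′ p∈Y′ =
    disjoint (Inverse.from A p) (pull X p∈X′) (pull Y p∈Y′)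
    where
    pull : ∀ Z → p ∈ₛ image Z → Inverse.from A p ∈ₛ Z
    pull Z p∈Z′ = Equivalence.from (exact Z _) (subst (_∈ₛ image Z) (sym (Inverse.strictlyInverseˡ A p)) p∈Z′)

data Coordinatewise (h : Point k → Point k) : Set where
  straight : (α β : Fin k → Fin k) → (∀ i j → h (i , j) ≡ (α i , β j)) → Coordinatewise h
  crossed  : (α β : Fin k → Fin k) → (∀ i j → h (i , j) ≡ (β j , α i)) → Coordinatewise h

-- Every automorphism of k² with k ≥ 3 acts coordinatewise: the rows, being pairwise disjoint,
-- go to all rows or all columns, and so do the columns, necessarily to the other family.
automorphism-coordinatewise : 3 ℕ.≤ k → (A : Point k ↔ Point k) → IsCubeAutomorphism A →
                              Coordinatewise (Inverse.to A)
automorphism-coordinatewise 3≤k A automorphism =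
  combine (disjoint-family 3≤k rows (λ r r′ r≢r′ → image-disjoint (row r) (row r′) (rows-disjoint r≢r′)))
          (disjoint-family 3≤k columns
            (λ c c′ c≢c′ → image-disjoint (column c) (column c′) (columns-disjoint c≢c′)))
  where
  2≤k : 2 ℕ.≤ _
  2≤k = ≤-trans (n≤1+n 2) 3≤k
  open ShapeAction A automorphism 2≤k
  open Inverse A using (to)

  rows columns : Fin _ → Shape _
  rows    r = image (row r)
  columns c = image (column c)

  rows-disjoint : ∀ {r r′} → r ≢ r′ → Disjoint (row r) (row r′)
  rows-disjoint r≢r′ _ p∈r p∈r′ = r≢r′ (trans (sym p∈r) p∈r′)

  columns-disjoint : ∀ {c c′} → c ≢ c′ → Disjoint (column c) (column c′)
  columns-disjoint c≢c′ _ p∈c p∈c′ = c≢c′ (trans (sym p∈c) p∈c′)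

  o : Fin _
  o = origin 2≤k

  combine : AllRows rows ⊎ AllColumns rows → AllRows columns ⊎ AllColumns columns → Coordinatewise to
  combine (inj₁ R) (inj₂ C) = straight (proj₁ ∘ R) (proj₁ ∘ C) λ i j →
    cong₂ _,_ (Equivalence.to (on-row (row i) (proj₂ (R i)) (i , j)) refl)
              (Equivalence.to (on-column (column j) (proj₂ (C j)) (i , j)) refl)
  combine (inj₂ R) (inj₁ C) = crossed (proj₁ ∘ R) (proj₁ ∘ C) λ i j →
    cong₂ _,_ (Equivalence.to (on-row (column j) (proj₂ (C j)) (i , j)) refl)
              (Equivalence.to (on-column (row i) (proj₂ (R i)) (i , j)) refl)
  -- If rows and columns both went to rows, (a, o) would lie on every row b: impossible as k ≥ 2.
  combine (inj₁ R) (inj₁ C) = ⊥-elim (ascending-moves 2≤k λ a b →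
    Equivalence.from (on-row (row b) (proj₂ (R b)) (a , o))
      (trans (Equivalence.to (on-row (column o) (proj₂ (C o)) (a , o)) refl)
      (trans (sym (Equivalence.to (on-row (column o) (proj₂ (C o)) (b , o)) refl))
             (Equivalence.to (on-row (row b) (proj₂ (R b)) (b , o)) refl))))
  combine (inj₂ R) (inj₂ C) = ⊥-elim (ascending-moves 2≤k λ a b →
    Equivalence.from (on-column (column b) (proj₂ (C b)) (o , a))
      (trans (Equivalence.to (on-column (row o) (proj₂ (R o)) (o , a)) refl)
      (trans (sym (Equivalence.to (on-column (row o) (proj₂ (R o)) (o , b)) refl))
             (Equivalence.to (on-column (column b) (proj₂ (C b)) (o , b)) refl))))

coordinates-injective : {h : Point k → Point k} {α β : Fin k → Fin k} → Injective _≡_ _≡_ h → Fin k →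
                        (∀ i j → h (i , j) ≡ (α i , β j)) → Injective _≡_ _≡_ α × Injective _≡_ _≡_ β
coordinates-injective {h = h} {α} {β} h-injective o h≡α×β =
  (λ {a} {b} αa≡αb → cong proj₁ (h-injective (begin
     h (a , o)   ≡⟨ h≡α×β a o ⟩
     (α a , β o) ≡⟨ cong (_, β o) αa≡αb ⟩
     (α b , β o) ≡⟨ h≡α×β b o ⟨
     h (b , o)   ∎))) ,
  (λ {a} {b} βa≡βb → cong proj₂ (h-injective (begin
     h (o , a)   ≡⟨ h≡α×β o a ⟩
     (α o , β a) ≡⟨ cong (α o ,_) βa≡βb ⟩
     (α o , β b) ≡⟨ h≡α×β o b ⟨
     h (o , b)   ∎)))
  where open ≡-Reasoning

diagonal-image : 2 ℕ.≤ k → (A : Point k ↔ Point k) → IsCubeAutomorphism A → {f g : Fin k → Fin k} →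
                 Injective _≡_ _≡_ f → Injective _≡_ _≡_ g → (∀ i → Inverse.to A (i , i) ≡ (f i , g i)) →
                 (∀ i → f i ≡ g i) ⊎ (∀ i → g i ≡ opposite (f i))
diagonal-image 2≤k A automorphism {f} {g} f-injective g-injective A-on-diagonal =
  classify (image diagonal) on-image
  where
  open ShapeAction A automorphism 2≤k
  on-image : ∀ i → (f i , g i) ∈ₛ image diagonal
  on-image i = subst (_∈ₛ _) (A-on-diagonal i) (Equivalence.to (exact diagonal (i , i)) refl)

  classify : ∀ X → (∀ i → (f i , g i) ∈ₛ X) → (∀ i → f i ≡ g i) ⊎ (∀ i → g i ≡ opposite (f i))
  classify (row _)      on = ⊥-elim (injective-moves 2≤k f-injective (λ i j → trans (on i) (sym (on j))))
  classify (column _)   on = ⊥-elim (injective-moves 2≤k g-injective (λ i j → trans (on i) (sym (on j))))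
  classify diagonal     on = inj₁ on
  classify antidiagonal on = inj₂ on

square : (Fin k ↔ Fin k) → (Point k ↔ Point k)
square φ = mk↔ₛ′ (λ (i , j) → to i , to j) (λ (i , j) → from i , from j)
                 (λ (i , j) → cong₂ _,_ (strictlyInverseˡ i) (strictlyInverseˡ j))
                 (λ (i , j) → cong₂ _,_ (strictlyInverseʳ i) (strictlyInverseʳ j))
  where open Inverse φ

-- If φ commutes with `opposite`, then φ × φ permutes the shapes, hence is a cube automorphism.
square-automorphism : (φ : Fin k ↔ Fin k) → (∀ x → Inverse.to φ (opposite x) ≡ opposite (Inverse.to φ x)) →
                      IsCubeAutomorphism (square φ)
square-automorphism φ φ-opposite S line with line⇒shape line
... | X , S⇔X = isLine-⇔ image⇔ (shape-isLine (line⇒2≤k line) (shapeMap X))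
  where
  open Inverse φ

  from-opposite : ∀ x → from (opposite x) ≡ opposite (from x)
  from-opposite x = begin
    from (opposite x)               ≡⟨ cong (from ∘ opposite) (strictlyInverseˡ x) ⟨
    from (opposite (to (from x)))   ≡⟨ cong from (φ-opposite (from x)) ⟨
    from (to (opposite (from x)))   ≡⟨ strictlyInverseʳ _ ⟩
    opposite (from x)               ∎
    where open ≡-Reasoning

  shapeMap : Shape _ → Shape _
  shapeMap (row a)      = row (to a)
  shapeMap (column b)   = column (to b)
  shapeMap diagonal     = diagonal
  shapeMap antidiagonal = antidiagonal

  forth : ∀ X v → v ∈ₛ X → Inverse.to (square φ) v ∈ₛ shapeMap X
  forth (row a)      _ refl = refl
  forth (column b)   _ refl = refl
  forth diagonal     _ refl = refl
  forth antidiagonal _ refl = φ-opposite _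

  back : ∀ X p → p ∈ₛ shapeMap X → Inverse.from (square φ) p ∈ₛ X
  back (row a)      _ refl = strictlyInverseʳ a
  back (column b)   _ refl = strictlyInverseʳ b
  back diagonal     _ refl = refl
  back antidiagonal _ refl = from-opposite _

  image⇔ : ∀ p → Image (Inverse.to (square φ)) S p ⇔ p ∈ₛ shapeMap X
  image⇔ p = mk⇔ (λ { (v , v∈S , refl) → forth X v (Equivalence.to (S⇔X v) v∈S) })
                 (λ p∈X′ → Inverse.from (square φ) p , Equivalence.from (S⇔X _) (back X p p∈X′) ,
                           Inverse.strictlyInverseˡ (square φ) p)

square-root : (A : Point k ↔ Point k) {α : Fin k → Fin k} → (∀ i j → Inverse.to A (i , j) ≡ (α i , α j)) →
              Fin k ↔ Fin k
square-root A {α} A≡α×α = mk↔ₛ′ α α⁻¹ α-α⁻¹ α⁻¹-α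
  where
  open Inverse A
  α⁻¹ : _
  α⁻¹ y = proj₁ (from (y , y))

  α-α⁻¹ : ∀ y → α (α⁻¹ y) ≡ y
  α-α⁻¹ y = cong proj₁ (trans (sym (A≡α×α _ _)) (strictlyInverseˡ (y , y)))

  α⁻¹-α : ∀ x → α⁻¹ (α x) ≡ x
  α⁻¹-α x = trans (cong (proj₁ ∘ from) (sym (A≡α×α x x))) (cong proj₁ (strictlyInverseʳ (x , x)))

side-split : ∀ n → 2 * n + 4 ≡ suc (suc n) + suc (suc n)
side-split n = begin
  2 * n + 4                    ≡⟨ cong (λ m → n + m + 4) (+-identityʳ n) ⟩
  n + n + 4                    ≡⟨ +-assoc n n 4 ⟩
  n + (n + 4)                  ≡⟨ cong (n +_) (+-comm n 4) ⟩
  n + suc (suc (suc (suc n)))  ≡⟨ +-suc n _ ⟩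
  suc (n + suc (suc (suc n)))  ≡⟨ cong suc (+-suc n _) ⟩
  suc (suc n) + suc (suc n)    ∎
  where open ≡-Reasoning

-- The colouring s^G of K², K = 2n + 4.  On the side [K] the points 0,…,n−1 are the vertices of G,
-- n and n + 1 are the `apex` points (s^G colours (n, n) and (n, n + 1)), and the last n points are
-- the opposites of the vertices.
module Colouring (n : ℕ) where

  K : ℕ
  K = 2 * n + 4

  1+n<K : suc n ℕ.< K
  1+n<K = subst (suc n ℕ.<_) (sym (side-split n)) (m≤m+n (suc (suc n)) (suc (suc n)))

  n<K : n ℕ.< K
  n<K = <-trans (n<1+n n) 1+n<K

  3≤K : 3 ℕ.≤ K
  3≤K = ≤-trans (n≤1+n 3) (m≤n+m 4 (2 * n))

  -- No point x has x ≤ n and opposite x ≤ n + 1, as these values sum to K − 1 = 2n + 3.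
  low-pair : ∀ (x : Fin K) → toℕ x ℕ.≤ n → toℕ (opposite x) ℕ.≤ suc n → ⊥
  low-pair x x≤n x̄≤1+n = <⇒≱ K-large (begin
    K                                ≡⟨ opposite-sum x ⟨
    toℕ (opposite x) + suc (toℕ x)   ≤⟨ +-mono-≤ x̄≤1+n (s≤s x≤n) ⟩
    suc n + suc n                    ∎)
    where
    open ≤-Reasoning
    K-large : suc n + suc n ℕ.< K
    K-large = subst (suc n + suc n ℕ.<_) (sym (side-split n)) (s≤s (+-monoʳ-≤ (suc n) (n≤1+n (suc n))))

  Inner : Fin K → Set
  Inner x = toℕ x ℕ.< n

  vertex : Fin n → Fin K
  vertex u = inject≤ u (<⇒≤ n<K)

  toℕ-vertex : ∀ u → toℕ (vertex u) ≡ toℕ u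
  toℕ-vertex u = toℕ-inject≤ u _

  vertex-inner : ∀ u → Inner (vertex u)
  vertex-inner u = subst (ℕ._< n) (sym (toℕ-vertex u)) (toℕ<n u)

  vertex-injective : Injective _≡_ _≡_ vertex
  vertex-injective {a} {b} e = toℕ-injective (trans (sym (toℕ-vertex a)) (trans (cong toℕ e) (toℕ-vertex b)))

  inner⇒vertex : ∀ {x} (x<n : Inner x) → vertex (fromℕ< x<n) ≡ x
  inner⇒vertex x<n = toℕ-injective (trans (toℕ-vertex _) (toℕ-fromℕ< x<n))

  outer-not-inner : ∀ u → ¬ Inner (opposite (vertex u))
  outer-not-inner u ū<n = low-pair (vertex u) (<⇒≤ (vertex-inner u)) (≤-trans (<⇒≤ ū<n) (n≤1+n n))

  apex apex′ : Fin K
  apex  = fromℕ< n<K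
  apex′ = fromℕ< 1+n<K

  toℕ-apex : toℕ apex ≡ n
  toℕ-apex = toℕ-fromℕ< n<K

  toℕ-apex′ : toℕ apex′ ≡ suc n
  toℕ-apex′ = toℕ-fromℕ< 1+n<K

  apex-not-inner : ¬ Inner apex
  apex-not-inner = <-irrefl toℕ-apex

  vertex≢apex : ∀ u → vertex u ≢ apex
  vertex≢apex u e = apex-not-inner (subst Inner e (vertex-inner u))

  apexColour : ℕ → ℕ → Bool
  apexColour a b = (a ≡ᵇ n) ∧ ((b ≡ᵇ n) ∨ (b ≡ᵇ suc n))

  apexColour-true : ∀ a b → apexColour a b ≡ true → a ≡ n × (b ≡ n ⊎ b ≡ suc n)
  apexColour-true a b coloured = conclude (Equivalence.to T-∧ (Equivalence.from T-≡ coloured))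
    where
    conclude : T (a ≡ᵇ n) × T ((b ≡ᵇ n) ∨ (b ≡ᵇ suc n)) → a ≡ n × (b ≡ n ⊎ b ≡ suc n)
    conclude (a≡n , b≡n∨1+n) =
      ≡ᵇ⇒≡ a n a≡n , Sum.map (≡ᵇ⇒≡ b n) (≡ᵇ⇒≡ b (suc n)) (Equivalence.to T-∨ b≡n∨1+n)

  apexColour-intro : ∀ {a b} → a ≡ n → b ≡ n ⊎ b ≡ suc n → apexColour a b ≡ true
  apexColour-intro {a} {b} a≡n b≡n∨1+n = Equivalence.to T-≡ (Equivalence.from T-∧
    (≡⇒≡ᵇ a n a≡n , Equivalence.from T-∨ (Sum.map (≡⇒≡ᵇ b n) (≡⇒≡ᵇ b (suc n)) b≡n∨1+n)))

  module _ (G : SimpleGraph n) where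

    s-vertices : ∀ a b → s G (vertex a , vertex b) ≡ adj G a b
    s-vertices a b with toℕ (vertex a) <? n | toℕ (vertex b) <? n
    ... | yes a<n | yes b<n = cong₂ (adj G) (vertex-injective (inner⇒vertex a<n)) (vertex-injective (inner⇒vertex b<n))
    ... | no a≮n  | _       = ⊥-elim (a≮n (vertex-inner a))
    ... | yes _   | no b≮n  = ⊥-elim (b≮n (vertex-inner b))

    s-outer : ∀ {i j} → ¬ Inner i ⊎ ¬ Inner j → s G (i , j) ≡ apexColour (toℕ i) (toℕ j)
    s-outer {i} {j} outside with toℕ i <? n | toℕ j <? n
    ... | yes i<n | yes j<n = ⊥-elim ([ (λ h → h i<n) , (λ h → h j<n) ]′ outside)
    ... | yes _   | no _    = refl
    ... | no _    | _       = refl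

    s-true : ∀ {i j} → s G (i , j) ≡ true →
             (∃ λ a → ∃ λ b → i ≡ vertex a × j ≡ vertex b × adj G a b ≡ true) ⊎
             (toℕ i ≡ n × (toℕ j ≡ n ⊎ toℕ j ≡ suc n))
    s-true {i} {j} coloured with toℕ i <? n | toℕ j <? n
    ... | yes i<n | yes j<n = inj₁ (fromℕ< i<n , fromℕ< j<n , sym (inner⇒vertex i<n) , sym (inner⇒vertex j<n) , coloured)
    ... | yes _   | no _    = inj₂ (apexColour-true _ _ coloured)
    ... | no _    | _       = inj₂ (apexColour-true _ _ coloured)

    coloured-bounds : ∀ {i j} → s G (i , j) ≡ true → toℕ i ℕ.≤ n × toℕ j ℕ.≤ suc n
    coloured-bounds coloured with s-true coloured
    ... | inj₁ (a , b , refl , refl , _) = <⇒≤ (vertex-inner a) , ≤-trans (<⇒≤ (vertex-inner b)) (n≤1+n n)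
    ... | inj₂ (i≡n , inj₁ j≡n)          = ≤-reflexive i≡n , ≤-trans (≤-reflexive j≡n) (n≤1+n n)
    ... | inj₂ (i≡n , inj₂ j≡1+n)        = ≤-reflexive i≡n , ≤-reflexive j≡1+n

    -- The only coloured point of the diagonal is (n, n), since G has no loops ...
    coloured-diagonal : ∀ {x} → s G (x , x) ≡ true → toℕ x ≡ n
    coloured-diagonal coloured with s-true coloured
    ... | inj₁ (a , b , x≡a , x≡b , edge) with vertex-injective (trans (sym x≡a) x≡b)
    ...   | refl with trans (sym (adj-irrefl G a)) edge
    ...     | ()
    coloured-diagonal coloured | inj₂ (x≡n , _) = x≡n

    coloured-column-n : ∀ {x y} → s G (x , y) ≡ true → toℕ y ≡ n → toℕ x ≡ n
    coloured-column-n coloured y≡n with s-true coloured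
    ... | inj₁ (a , b , _ , refl , _) = ⊥-elim (<-irrefl y≡n (vertex-inner b))
    ... | inj₂ (x≡n , _)              = x≡n

    antidiagonal-uncoloured : ∀ x → s G (x , opposite x) ≢ true
    antidiagonal-uncoloured x coloured = uncurry (low-pair x) (coloured-bounds coloured)

    apex-coloured : s G (apex , apex) ≡ true
    apex-coloured = trans (s-outer (inj₁ apex-not-inner)) (apexColour-intro toℕ-apex (inj₁ toℕ-apex))

    apex′-coloured : s G (apex , apex′) ≡ true
    apex′-coloured = trans (s-outer (inj₁ apex-not-inner)) (apexColour-intro toℕ-apex (inj₂ toℕ-apex′))

  apex-middle : ∀ {x} → n ℕ.≤ toℕ x → toℕ x ℕ.≤ suc n → ¬ Inner x × ¬ Inner (opposite x)
  apex-middle {x} n≤x x≤1+n =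
    (λ x<n → <⇒≱ x<n n≤x) ,
    (λ x̄<n → low-pair (opposite x) (<⇒≤ x̄<n) (subst (λ y → toℕ y ℕ.≤ suc n) (sym (opposite-involutive x)) x≤1+n))

  data Region (x : Fin K) : Set where
    inner  : ∀ u → x ≡ vertex u → Region x
    outer  : ∀ u → x ≡ opposite (vertex u) → Region x
    middle : ¬ Inner x → ¬ Inner (opposite x) → Region x

  region : ∀ x → Region x
  region x with toℕ x <? n | toℕ (opposite x) <? n
  ... | yes x<n | _        = inner (fromℕ< x<n) (sym (inner⇒vertex x<n))
  ... | no _    | yes x̄<n  = outer (fromℕ< x̄<n)
    (trans (sym (opposite-involutive x)) (cong opposite (sym (inner⇒vertex x̄<n))))
  ... | no x≮n  | no x̄≮n   = middle x≮n x̄≮n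

  module _ (f : Fin n → Fin n) where

    extendAt : ∀ {x} → Region x → Fin K
    extendAt (inner u _)  = vertex (f u)
    extendAt (outer u _)  = opposite (vertex (f u))
    extendAt {x} (middle _ _) = x

    extend : Fin K → Fin K
    extend x = extendAt (region x)

    -- The defining equations of `extend`, valid whatever region witness is computed.
    extend-vertex : ∀ u → extend (vertex u) ≡ vertex (f u)
    extend-vertex u = at (region (vertex u))
      where
      at : (r : Region (vertex u)) → extendAt r ≡ vertex (f u)
      at (inner u′ u≡u′)  = cong (vertex ∘ f) (sym (vertex-injective u≡u′))
      at (outer u′ u≡ū′)  = ⊥-elim (outer-not-inner u′ (subst Inner u≡ū′ (vertex-inner u)))
      at (middle u≮n _)   = ⊥-elim (u≮n (vertex-inner u))

    extend-outer : ∀ u → extend (opposite (vertex u)) ≡ opposite (vertex (f u))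
    extend-outer u = at (region (opposite (vertex u)))
      where
      at : (r : Region (opposite (vertex u))) → extendAt r ≡ opposite (vertex (f u))
      at (inner u′ ū≡u′)  = ⊥-elim (outer-not-inner u (subst Inner (sym ū≡u′) (vertex-inner u′)))
      at (outer u′ ū≡ū′)  = cong (opposite ∘ vertex ∘ f) (sym (vertex-injective (opposite-injective ū≡ū′)))
      at (middle _ ū̄≮n)   = ⊥-elim (ū̄≮n (subst Inner (sym (opposite-involutive (vertex u))) (vertex-inner u)))

    extend-middle : ∀ {x} → ¬ Inner x → ¬ Inner (opposite x) → extend x ≡ x
    extend-middle {x} x≮n x̄≮n = at (region x)
      where
      at : (r : Region x) → extendAt r ≡ x
      at (inner u x≡u)  = ⊥-elim (x≮n (subst Inner (sym x≡u) (vertex-inner u)))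
      at (outer u x≡ū)  =
        ⊥-elim (x̄≮n (subst Inner (sym (trans (cong opposite x≡ū) (opposite-involutive _))) (vertex-inner u)))
      at (middle _ _)   = refl

    extend-opposite : ∀ x → extend (opposite x) ≡ opposite (extend x)
    extend-opposite x = by-region (region x)
      where
      open ≡-Reasoning
      by-region : ∀ {x} → Region x → extend (opposite x) ≡ opposite (extend x)
      by-region (inner u refl) = trans (extend-outer u) (cong opposite (sym (extend-vertex u)))
      by-region (outer u refl) = begin
        extend (opposite (opposite (vertex u))) ≡⟨ cong extend (opposite-involutive (vertex u)) ⟩
        extend (vertex u)                       ≡⟨ extend-vertex u ⟩
        vertex (f u)                            ≡⟨ opposite-involutive (vertex (f u)) ⟨
        opposite (opposite (vertex (f u)))      ≡⟨ cong opposite (extend-outer u) ⟨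
        opposite (extend (opposite (vertex u))) ∎
      by-region {x} (middle x≮n x̄≮n) =
        trans (extend-middle x̄≮n (subst (λ y → ¬ Inner y) (sym (opposite-involutive x)) x≮n))
              (cong opposite (sym (extend-middle x≮n x̄≮n)))

    extend-outside : ∀ x → ¬ Inner x → ¬ Inner (extend x)
    extend-outside x = by-region (region x)
      where
      by-region : ∀ {x} → Region x → ¬ Inner x → ¬ Inner (extend x)
      by-region (inner u refl) u≮n     = ⊥-elim (u≮n (vertex-inner u))
      by-region (outer u refl) _       = subst (λ y → ¬ Inner y) (sym (extend-outer u)) (outer-not-inner (f u))
      by-region (middle x≮n x̄≮n) _    = subst (λ y → ¬ Inner y) (sym (extend-middle x≮n x̄≮n)) x≮n

  extend-inverse : {f g : Fin n → Fin n} → (∀ u → f (g u) ≡ u) → ∀ x → extend f (extend g x) ≡ x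
  extend-inverse {f} {g} f∘g≡id x = by-region (region x)
    where
    open ≡-Reasoning
    by-region : ∀ {x} → Region x → extend f (extend g x) ≡ x
    by-region (inner u refl) = begin
      extend f (extend g (vertex u)) ≡⟨ cong (extend f) (extend-vertex g u) ⟩
      extend f (vertex (g u))        ≡⟨ extend-vertex f (g u) ⟩
      vertex (f (g u))               ≡⟨ cong vertex (f∘g≡id u) ⟩
      vertex u                       ∎
    by-region (outer u refl) = begin
      extend f (extend g (opposite (vertex u))) ≡⟨ cong (extend f) (extend-outer g u) ⟩
      extend f (opposite (vertex (g u)))        ≡⟨ extend-outer f (g u) ⟩
      opposite (vertex (f (g u)))               ≡⟨ cong (opposite ∘ vertex) (f∘g≡id u) ⟩
      opposite (vertex u)                       ∎
    by-region (middle x≮n x̄≮n) = trans (cong (extend f) (extend-middle g x≮n x̄≮n)) (extend-middle f x≮n x̄≮n)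

  -- Outside the vertex square only the values n and n + 1 matter, and an injective φ fixing
  -- the apex points detects them exactly as before.
  apexColour-invariant : (φ : Fin K → Fin K) → Injective _≡_ _≡_ φ → φ apex ≡ apex → φ apex′ ≡ apex′ →
                         ∀ i j → apexColour (toℕ i) (toℕ j) ≡ apexColour (toℕ (φ i)) (toℕ (φ j))
  apexColour-invariant φ φ-injective keeps-apex keeps-apex′ i j =
    cong₂ _∧_ (detects keeps-apex toℕ-apex i)
              (cong₂ _∨_ (detects keeps-apex toℕ-apex j) (detects keeps-apex′ toℕ-apex′ j))
    where
    detects : ∀ {c m} → φ c ≡ c → toℕ c ≡ m → ∀ x → (toℕ x ≡ᵇ m) ≡ (toℕ (φ x) ≡ᵇ m)
    detects {c} φc≡c refl x = does-⇔ (mk⇔ forth back) (toℕ x ℕ.≟ toℕ c) (toℕ (φ x) ℕ.≟ toℕ c)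
      where
      forth : toℕ x ≡ toℕ c → toℕ (φ x) ≡ toℕ c
      forth x≡c = cong toℕ (trans (cong φ (toℕ-injective x≡c)) φc≡c)
      back : toℕ (φ x) ≡ toℕ c → toℕ x ≡ toℕ c
      back φx≡c = cong toℕ (φ-injective (trans (toℕ-injective φx≡c) (sym φc≡c)))

  colour-invariant : {G₁ G₂ : SimpleGraph n} (φ : Fin K → Fin K) (σ : Fin n → Fin n) →
    Injective _≡_ _≡_ φ → φ apex ≡ apex → φ apex′ ≡ apex′ → (∀ x → ¬ Inner x → ¬ Inner (φ x)) →
    (∀ u → φ (vertex u) ≡ vertex (σ u)) → (∀ u v → adj G₁ u v ≡ adj G₂ (σ u) (σ v)) →
    ∀ i j → s G₁ (i , j) ≡ s G₂ (φ i , φ j)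
  colour-invariant {G₁} {G₂} φ σ φ-injective keeps-apex keeps-apex′ outside on-vertices σ-preserves i j =
    by-region (toℕ i <? n) (toℕ j <? n)
    where
    open ≡-Reasoning
    outer-case : ¬ Inner i ⊎ ¬ Inner j → s G₁ (i , j) ≡ s G₂ (φ i , φ j)
    outer-case i∨j-outside = begin
      s G₁ (i , j)                        ≡⟨ s-outer G₁ i∨j-outside ⟩
      apexColour (toℕ i) (toℕ j)          ≡⟨ apexColour-invariant φ φ-injective keeps-apex keeps-apex′ i j ⟩
      apexColour (toℕ (φ i)) (toℕ (φ j))  ≡⟨ s-outer G₂ (Sum.map (outside i) (outside j) i∨j-outside) ⟨
      s G₂ (φ i , φ j)                    ∎

    by-region : Dec (Inner i) → Dec (Inner j) → s G₁ (i , j) ≡ s G₂ (φ i , φ j)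
    by-region (yes i<n) (yes j<n) = begin
      s G₁ (i , j)                         ≡⟨ cong₂ (λ x y → s G₁ (x , y)) (inner⇒vertex i<n) (inner⇒vertex j<n) ⟨
      s G₁ (vertex a , vertex b)           ≡⟨ s-vertices G₁ a b ⟩
      adj G₁ a b                           ≡⟨ σ-preserves a b ⟩
      adj G₂ (σ a) (σ b)                   ≡⟨ s-vertices G₂ (σ a) (σ b) ⟨
      s G₂ (vertex (σ a) , vertex (σ b))   ≡⟨ cong₂ (λ x y → s G₂ (x , y)) (on-vertices a) (on-vertices b) ⟨
      s G₂ (φ (vertex a) , φ (vertex b))   ≡⟨ cong₂ (λ x y → s G₂ (φ x , φ y)) (inner⇒vertex i<n) (inner⇒vertex j<n) ⟩
      s G₂ (φ i , φ j)                     ∎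
      where
      a b : Fin n
      a = fromℕ< i<n
      b = fromℕ< j<n
    by-region (no i≮n)  _         = outer-case (inj₁ i≮n)
    by-region (yes _)   (no j≮n)  = outer-case (inj₂ j≮n)

  -- The "only if" direction: extend the isomorphism σ to a permutation φ of the side commuting
  -- with `opposite`; then φ × φ is a colour-preserving cube automorphism.
  isomorphism⇒automorphism : {G₁ G₂ : SimpleGraph n} → Isomorphic G₁ G₂ →
    Σ (Point K ↔ Point K) λ A → IsCubeAutomorphism A × (∀ v → s G₁ v ≡ s G₂ (Inverse.to A v))
  isomorphism⇒automorphism (σ , σ-preserves) =
    square φ , square-automorphism φ (extend-opposite (to σ)) ,
    λ (i , j) → colour-invariant (extend (to σ)) (to σ) (Injection.injective (↔⇒↣ φ))
                  (fixes apex-middle-n) (fixes apex′-middle) (extend-outside (to σ)) (extend-vertex (to σ)) σ-preserves i j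
    where
    open Inverse using (to; from; strictlyInverseˡ; strictlyInverseʳ)

    φ : Fin K ↔ Fin K
    φ = mk↔ₛ′ (extend (to σ)) (extend (from σ))
              (extend-inverse (strictlyInverseˡ σ)) (extend-inverse (strictlyInverseʳ σ))

    fixes : ∀ {x} → ¬ Inner x × ¬ Inner (opposite x) → extend (to σ) x ≡ x
    fixes (x≮n , x̄≮n) = extend-middle (to σ) x≮n x̄≮n

    apex-middle-n : ¬ Inner apex × ¬ Inner (opposite apex)
    apex-middle-n = apex-middle (≤-reflexive (sym toℕ-apex)) (≤-trans (≤-reflexive toℕ-apex) (n≤1+n n))
    apex′-middle : ¬ Inner apex′ × ¬ Inner (opposite apex′)
    apex′-middle = apex-middle (≤-trans (n≤1+n n) (≤-reflexive (sym toℕ-apex′))) (≤-reflexive toℕ-apex′)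

  -- A colour-preserving map α × α (α injective) sends each vertex u of a graph without isolated
  -- vertices to a vertex: an edge at u yields a coloured point in row α u, so α u ≤ n, and
  -- α u ≠ n because α already sends the apex to a point of value n (the coloured diagonal point).
  vertices-to-vertices : {G H : SimpleGraph n} {α : Fin K → Fin K} → NoIsolated G → Injective _≡_ _≡_ α →
                         (∀ i j → s G (i , j) ≡ s H (α i , α j)) → ∀ u → Inner (α (vertex u))
  vertices-to-vertices {G} {H} {α} no-isolated α-injective preserves u =
    ≤∧≢⇒< (proj₁ (coloured-bounds H edge)) α-u≢n
    where
    w : Fin n
    w = proj₁ (no-isolated u)

    edge : s H (α (vertex u) , α (vertex w)) ≡ true
    edge = trans (sym (preserves (vertex u) (vertex w))) (trans (s-vertices G u w) (proj₂ (no-isolated u)))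

    α-apex : toℕ (α apex) ≡ n
    α-apex = coloured-diagonal H (trans (sym (preserves apex apex)) (apex-coloured G))

    α-u≢n : toℕ (α (vertex u)) ≢ n
    α-u≢n α-u≡n = vertex≢apex u (α-injective (toℕ-injective (trans α-u≡n (sym α-apex))))

  restrict : (α : Fin K → Fin K) → (∀ u → Inner (α (vertex u))) → Fin n → Fin n
  restrict α to-vertices u = fromℕ< (to-vertices u)

  vertex-restrict : (α : Fin K → Fin K) (to-vertices : ∀ u → Inner (α (vertex u))) →
                    ∀ u → vertex (restrict α to-vertices u) ≡ α (vertex u)
  vertex-restrict α to-vertices u = inner⇒vertex (to-vertices u)

  restriction-isomorphism : {G₁ G₂ : SimpleGraph n} → NoIsolated G₁ → NoIsolated G₂ → (α : Fin K ↔ Fin K) →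
                            (∀ i j → s G₁ (i , j) ≡ s G₂ (Inverse.to α i , Inverse.to α j)) → Isomorphic G₁ G₂
  restriction-isomorphism {G₁} {G₂} no-isolated₁ no-isolated₂ α preserves = mk↔ₛ′ σ τ σ-τ τ-σ , σ-preserves
    where
    open Inverse α using (to; from; strictlyInverseˡ; strictlyInverseʳ)
    open ≡-Reasoning

    preserves⁻¹ : ∀ i j → s G₂ (i , j) ≡ s G₁ (from i , from j)
    preserves⁻¹ i j = begin
      s G₂ (i , j)                         ≡⟨ cong₂ (λ x y → s G₂ (x , y)) (strictlyInverseˡ i) (strictlyInverseˡ j) ⟨
      s G₂ (to (from i) , to (from j))     ≡⟨ preserves (from i) (from j) ⟨
      s G₁ (from i , from j)               ∎

    to-inner : ∀ u → Inner (to (vertex u))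
    to-inner = vertices-to-vertices no-isolated₁ (Injection.injective (↔⇒↣ α)) preserves
    from-inner : ∀ u → Inner (from (vertex u))
    from-inner = vertices-to-vertices no-isolated₂ (Injection.injective (↔⇒↣ (↔-sym α))) preserves⁻¹

    σ τ : Fin n → Fin n
    σ = restrict to to-inner
    τ = restrict from from-inner

    σ-τ : ∀ v → σ (τ v) ≡ v
    σ-τ v = vertex-injective (begin
      vertex (σ (τ v))   ≡⟨ vertex-restrict to to-inner (τ v) ⟩
      to (vertex (τ v))  ≡⟨ cong to (vertex-restrict from from-inner v) ⟩
      to (from (vertex v)) ≡⟨ strictlyInverseˡ (vertex v) ⟩
      vertex v           ∎)

    τ-σ : ∀ u → τ (σ u) ≡ u
    τ-σ u = vertex-injective (begin
      vertex (τ (σ u))   ≡⟨ vertex-restrict from from-inner (σ u) ⟩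
      from (vertex (σ u)) ≡⟨ cong from (vertex-restrict to to-inner u) ⟩
      from (to (vertex u)) ≡⟨ strictlyInverseʳ (vertex u) ⟩
      vertex u           ∎)

    σ-preserves : ∀ u v → adj G₁ u v ≡ adj G₂ (σ u) (σ v)
    σ-preserves u v = begin
      adj G₁ u v                          ≡⟨ s-vertices G₁ u v ⟨
      s G₁ (vertex u , vertex v)          ≡⟨ preserves (vertex u) (vertex v) ⟩
      s G₂ (to (vertex u) , to (vertex v)) ≡⟨ cong₂ (λ x y → s G₂ (x , y)) (vertex-restrict to to-inner u) (vertex-restrict to to-inner v) ⟨
      s G₂ (vertex (σ u) , vertex (σ v))  ≡⟨ s-vertices G₂ (σ u) (σ v) ⟩
      adj G₂ (σ u) (σ v)                  ∎

  module _ {G₁ G₂ : SimpleGraph n} (A : Point K ↔ Point K) (automorphism : IsCubeAutomorphism A)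
           (preserves : ∀ v → s G₁ v ≡ s G₂ (Inverse.to A v)) where
    private
      open Inverse A using (to)

      A-injective : Injective _≡_ _≡_ to
      A-injective = Injection.injective (↔⇒↣ A)

      2≤K : 2 ℕ.≤ K
      2≤K = ≤-trans (n≤1+n 2) 3≤K

      coloured-image : ∀ {v p} → s G₁ v ≡ true → to v ≡ p → s G₂ p ≡ true
      coloured-image {v} coloured refl = trans (sym (preserves v)) coloured

    -- The apex (n, n) is coloured, so its image does not lie on the antidiagonal.
    apex-image-off-antidiagonal : ∀ x → to (apex , apex) ≢ (x , opposite x)
    apex-image-off-antidiagonal x A-apex≡ = antidiagonal-uncoloured G₂ x (coloured-image (apex-coloured G₁) A-apex≡)

    -- If A = α × β then the diagonal goes to the diagonal, i.e. β = α.
    straight-is-square : {α β : Fin K → Fin K} → (∀ i j → to (i , j) ≡ (α i , β j)) → ∀ i → α i ≡ β i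
    straight-is-square {α} {β} A≡α×β =
      [ (λ α≡β → α≡β) , (λ β≡ᾱ → ⊥-elim (apex-image-off-antidiagonal (α apex)
                                  (trans (A≡α×β apex apex) (cong (α apex ,_) (β≡ᾱ apex))))) ]′
        (diagonal-image 2≤K A automorphism (proj₁ injective) (proj₂ injective) (λ i → A≡α×β i i))
      where
      injective : Injective _≡_ _≡_ α × Injective _≡_ _≡_ β
      injective = coordinates-injective A-injective apex A≡α×β

    -- A cannot exchange the coordinates: the diagonal would go to the antidiagonal, or onto
    -- itself with column n of the image containing the images of both apex points.
    not-crossed : {α β : Fin K → Fin K} → (∀ i j → to (i , j) ≡ (β j , α i)) → ⊥
    not-crossed {α} {β} A≡β×α = [ along , across ]′
        (diagonal-image 2≤K A automorphism β-injective α-injective (λ i → A≡β×α i i))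
      where
      injective : Injective _≡_ _≡_ α × Injective _≡_ _≡_ β
      injective = coordinates-injective {h = swap ∘ to} (A-injective ∘ cong swap) apex (λ i j → cong swap (A≡β×α i j))

      α-injective : Injective _≡_ _≡_ α
      α-injective = proj₁ injective

      β-injective : Injective _≡_ _≡_ β
      β-injective = proj₂ injective

      along : (∀ i → β i ≡ α i) → ⊥
      along β≡α = 1+n≢n (begin
        suc n     ≡⟨ toℕ-apex′ ⟨
        toℕ apex′ ≡⟨ cong toℕ (β-injective (toℕ-injective (trans β-apex′ (sym β-apex)))) ⟩
        toℕ apex  ≡⟨ toℕ-apex ⟩
        n         ∎)
        where
        open ≡-Reasoning
        β-apex : toℕ (β apex) ≡ n
        β-apex = coloured-diagonal G₂
          (coloured-image (apex-coloured G₁) (trans (A≡β×α apex apex) (cong (β apex ,_) (sym (β≡α apex)))))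
        β-apex′ : toℕ (β apex′) ≡ n
        β-apex′ = coloured-column-n G₂
          (coloured-image (apex′-coloured G₁) (trans (A≡β×α apex apex′) (cong (β apex′ ,_) (sym (β≡α apex))))) β-apex

      across : (∀ i → α i ≡ opposite (β i)) → ⊥
      across α≡β̄ = apex-image-off-antidiagonal (β apex) (trans (A≡β×α apex apex) (cong (β apex ,_) (α≡β̄ apex)))

    square-form : Σ (Fin K → Fin K) λ α → ∀ i j → to (i , j) ≡ (α i , α j)
    square-form = square-of (automorphism-coordinatewise 3≤K A automorphism)
      where
      square-of : Coordinatewise to → Σ (Fin K → Fin K) λ α → ∀ i j → to (i , j) ≡ (α i , α j)
      square-of (straight α β A≡α×β) =
        α , λ i j → trans (A≡α×β i j) (cong (α i ,_) (sym (straight-is-square A≡α×β j)))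
      square-of (crossed  α β A≡β×α) = ⊥-elim (not-crossed A≡β×α)

  automorphism⇒isomorphism : {G₁ G₂ : SimpleGraph n} → NoIsolated G₁ → NoIsolated G₂ →
    (Σ (Point K ↔ Point K) λ A → IsCubeAutomorphism A × (∀ v → s G₁ v ≡ s G₂ (Inverse.to A v))) →
    Isomorphic G₁ G₂
  automorphism⇒isomorphism {G₁} {G₂} no-isolated₁ no-isolated₂ (A , automorphism , preserves) =
    restrict-square (square-form A automorphism preserves)
    where
    restrict-square : (Σ (Fin K → Fin K) λ α → ∀ i j → Inverse.to A (i , j) ≡ (α i , α j)) → Isomorphic G₁ G₂
    restrict-square (α , A≡α×α) = restriction-isomorphism no-isolated₁ no-isolated₂ (square-root A A≡α×α)
      (λ i j → trans (preserves (i , j)) (cong (s G₂) (A≡α×α i j)))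

open Colouring using (isomorphism⇒automorphism; automorphism⇒isomorphism)

theorem8 : (n : ℕ) (G₁ G₂ : SimpleGraph n) → NoIsolated G₁ → NoIsolated G₂ →
    (Isomorphic G₁ G₂ ⇔
      (Σ (Point (2 * n + 4) ↔ Point (2 * n + 4)) λ A →
        IsCubeAutomorphism A × (∀ v → s G₁ v ≡ s G₂ (Inverse.to A v))))
theorem8 n G₁ G₂ no-isolated₁ no-isolated₂ =
  mk⇔ (isomorphism⇒automorphism n) (automorphism⇒isomorphism n no-isolated₁ no-isolated₂)
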